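{- Let $X$ be a finite set, $G\in\mathcal{H}[X]$ and $\leftthreetimes\in\{\subset,\cap\}$. (1) If $\sim\leqslant\sim'$ in $\mathcal{E}[X]$, then the hypergraphs $(G/\sim')/\overline{\sim}$ and $G/\sim$ are equal. (2) Let $\sim\in\mathcal{E}[X]$. Then $\sim\in\mathcal{E}_\leftthreetimes[G]$ if and only if the connected components of $G\mid_\leftthreetimes\sim$ are the classes of $\sim$. (3) Let $\sim\in\mathcal{E}_\leftthreetimes[G]$. The connected components of $G/\sim$ are the images by $\pi_\sim$ of the connected components of $G$. (4) Let $\sim\leqslant\sim'$ in $\mathcal{E}[X]$. Then ($\sim'\in\mathcal{E}_\leftthreetimes[G]$ and $\overline{\sim}\in\mathcal{E}_\leftthreetimes[G/\sim']$) if and only if ($\sim\in\mathcal{E}_\leftthreetimes[G]$ and $\sim'\in\mathcal{E}_\leftthreetimes[G\mid_\leftthreetimes\sim]$). If this holds, $(G/\sim')\mid_\leftthreetimes\overline{\sim}=(G\mid_\leftthreetimes\sim)/\sim'$.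
   Context: A hypergraph is a pair $G=(V(G),E(G))$ with $V(G)$ finite and $E(G)\subseteq\mathcal{P}(V(G))$ containing $\emptyset$ and all singletons $\{x\}$, $x\in V(G)$; $\mathcal{H}[X]$ is the set of hypergraphs with vertex set $X$. For $I\subseteq V(G)$: $G_{\mid_\subset I}$ has vertex set $I$ and edges $\{e\in E(G)\mid e\subseteq I\}$; $G_{\mid_\cap I}$ has vertex set $I$ and edges $\{e\cap I\mid e\in E(G)\}$. For hypergraphs with disjoint vertex sets, the product $GG'$ has vertex set $V(G)\sqcup V(G')$ and edge set $E(G)\cup E(G')$. A path in $G$ is a sequence $(x_0,\dots,x_k)$ of vertices such that for each $i$ some edge contains $x_{i-1}$ and $x_i$; $G$ is connected if any two vertices are joined by a path; connected components are defined accordingly. $\mathcal{E}[X]$ is the set of equivalence relations on $X$, ordered by $\sim\leqslant\sim'$ iff ($x\sim' y\Rightarrow x\sim y$). If $\sim\leqslant\sim'$, $\overline{\sim}$ is the equivalence on $X/\sim'$ given by $\overline{x}\,\overline{\sim}\,\overline{y}\iff x\sim y$. For $\sim\in\mathcal{E}[X]$ with canonical surjection $\pi_\sim:X\to X/\sim$: $G/\sim$ is the hypergraph with vertex set $X/\sim$ and edges $\{\pi_\sim(e)\mid e\in E(G)\}$; $G\mid_\leftthreetimes\sim=\prod_{C\in X/\sim}G_{\mid_\leftthreetimes C}$ (a hypergraph on $X$); $\sim\in\mathcal{E}_\leftthreetimes[G]$ means that $G_{\mid_\leftthreetimes C}$ is connected for every class $C$ of $\sim$. -}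

module Defs where

open import Level using (0ℓ)
open import Data.Nat using (ℕ)
open import Data.Fin using (Fin)
open import Data.Product using (Σ; Σ-syntax; _×_; _,_; proj₁; proj₂)
open import Relation.Nullary using (¬_)
open import Relation.Unary using (Pred)
open import Relation.Binary using (Rel; IsEquivalence; Setoid)
import Relation.Binary.PropositionalEquality as P
import Relation.Binary.Construct.On as On
open import Relation.Binary.Construct.Closure.ReflexiveTransitive using (Star)
open import Function.Bundles using (_⇔_)

-- Agda (without cubical) has no quotient types, so a vertex set is modelled
-- as a setoid: a carrier of representatives plus an equivalence relation _≈_
-- telling when two representatives denote the same vertex.  The base finite
-- set X is Fin n with propositional equality; a quotient V/~ and a subset
-- I ⊆ V are again setoids (see _/ˢ_ and _∣ˢ_ below).

VSet : Set₁
VSet = Setoid 0ℓ 0ℓ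

FinS : ℕ → VSet
FinS n = P.setoid (Fin n)

module _ (S : VSet) where
  open Setoid S

  -- subsets of the vertex set (as predicates on representatives;
  -- the ones that matter respect _≈_)
  Subset : Set₁
  Subset = Pred Carrier 0ℓ

  _≐_ : Subset → Subset → Set
  A ≐ B = ∀ x → (A x ⇔ B x)

  _⊆_ : Subset → Subset → Set
  A ⊆ B = ∀ x → A x → B x

  -- a "set of subsets", given as an indexed family
  record Family : Set₁ where
    field
      Idx : Set
      mem : Idx → Subset

  _≈F_ : Family → Family → Set
  F ≈F F' = (∀ i → Σ[ j ∈ Family.Idx F' ] (Family.mem F i ≐ Family.mem F' j))
          × (∀ j → Σ[ i ∈ Family.Idx F ] (Family.mem F i ≐ Family.mem F' j))

  record Hypergraph : Set₁ where
    field
      Index : Set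
      edge  : Index → Subset

  open Hypergraph public

  record IsHypergraph (G : Hypergraph) : Set where
    field
      edge-resp : ∀ i {x y} → x ≈ y → edge G i x → edge G i y
      empty     : Σ[ i ∈ Index G ] (∀ x → ¬ edge G i x)
      singleton : ∀ x → Σ[ i ∈ Index G ] (∀ y → (edge G i y ⇔ x ≈ y))

  _≈H_ : Hypergraph → Hypergraph → Set
  G ≈H G' = (∀ i → Σ[ j ∈ Index G' ] (edge G i ≐ edge G' j))
          × (∀ j → Σ[ i ∈ Index G ] (edge G i ≐ edge G' j))

  edges : Hypergraph → Family
  edges G = record { Idx = Index G ; mem = edge G }

  Adj : Hypergraph → Rel Carrier 0ℓ
  Adj G x y = Σ[ i ∈ Index G ] (edge G i x × edge G i y)

  Path : Hypergraph → Rel Carrier 0ℓ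
  Path G x y = Σ[ x₀ ∈ Carrier ] Σ[ xₖ ∈ Carrier ]
                 (x ≈ x₀ × Star (Adj G) x₀ xₖ × xₖ ≈ y)

  Connected : Hypergraph → Set
  Connected G = ∀ x y → Path G x y

  component : Hypergraph → Carrier → Subset
  component G x = λ y → Path G x y

  components : Hypergraph → Family
  components G = record { Idx = Carrier ; mem = component G }

  -- Equivalence relations on the vertex set (i.e. on V = Carrier/≈):
  -- relations on representatives which are coarser than ≈.
  record Equiv : Set₁ where
    field
      rel     : Rel Carrier 0ℓ
      isEquiv : IsEquivalence rel
      coarser : ∀ {x y} → x ≈ y → rel x y

  open Equiv public

  _≤E_ : Equiv → Equiv → Set
  R ≤E R' = ∀ x y → rel R' x y → rel R x y

  class : Equiv → Carrier → Subset
  class R x = λ y → rel R x y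

  classes : Equiv → Family
  classes R = record { Idx = Carrier ; mem = class R }

  -- π_R(A): image of a subset of V in V/R (a subset of V/R, given
  -- by its R-saturated set of representatives)
  image : Equiv → Subset → Subset
  image R A = λ y → Σ[ z ∈ Carrier ] (A z × rel R z y)


_/ˢ_ : (S : VSet) → Equiv S → VSet
S /ˢ R = record
  { Carrier       = Setoid.Carrier S
  ; _≈_           = rel R
  ; isEquivalence = isEquiv R
  }

imageFam : (S : VSet) (R : Equiv S) → Family S → Family (S /ˢ R)
imageFam S R F = record
  { Idx = Family.Idx F
  ; mem = λ i → image S R (Family.mem F i)
  }

_∣ˢ_ : (S : VSet) → Subset S → VSet
S ∣ˢ I = record
  { Carrier       = Σ (Setoid.Carrier S) I
  ; _≈_           = λ a b → Setoid._≈_ S (proj₁ a) (proj₁ b)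
  ; isEquivalence = On.isEquivalence proj₁ (Setoid.isEquivalence S)
  }

_/_ : {S : VSet} → Hypergraph S → (R : Equiv S) → Hypergraph (S /ˢ R)
_/_ {S} G R = record
  { Index = Index G
  ; edge  = λ i → image S R (edge G i)
  }

bar : {S : VSet} (R R' : Equiv S) → _≤E_ S R R' → Equiv (S /ˢ R')
bar R R' le = record
  { rel     = rel R
  ; isEquiv = isEquiv R
  ; coarser = λ {x} {y} → le x y
  }

data Mode : Set where
  ⊂ ∩ : Mode

restrict : {S : VSet} → Mode → Hypergraph S → (I : Subset S) → Hypergraph (S ∣ˢ I)
restrict {S} ⊂ G I = record
  { Index = Σ[ i ∈ Index G ] (_⊆_ S (edge G i) I)
  ; edge  = λ j a → edge G (proj₁ j) (proj₁ a)
  }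
restrict {S} ∩ G I = record
  { Index = Index G
  ; edge  = λ i a → edge G i (proj₁ a)
  }

-- G_{|⋉} R = ∏_{C ∈ V/R} G_{|⋉ C}: the product of the restrictions to the
-- classes; its edge set is the union of the edge sets of the G_{|⋉ C}
-- (each edge of G_{|⋉ C} being a subset of C ⊆ V).
prodRestrict : {S : VSet} → Mode → Hypergraph S → Equiv S → Hypergraph S
prodRestrict {S} m G R = record
  { Index = Σ[ x ∈ Setoid.Carrier S ] Index (restrict m G (class S R x))
  ; edge  = λ j y → Σ[ p ∈ rel R (proj₁ j) y ]
                      edge (restrict m G (class S R (proj₁ j))) (proj₂ j) (y , p)
  }

EConn : {S : VSet} → Mode → Hypergraph S → Equiv S → Set
EConn {S} m G R = ∀ x → Connected (S ∣ˢ class S R x) (restrict m G (class S R x))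

-- Everything is reduced to chains, sequences of steps each joining equal or
-- adjacent vertices; once edges respect the setoid equality, chains and paths
-- connect the same vertices.  Each part then amounts to showing that steps of
-- one hypergraph become chains of another.  The one substantial step is in (4):
-- an edge of G/∼' touches the ∼'-classes of its endpoints, and connectivity of
-- G inside each ∼'-class replaces it by a chain of G inside a single ∼-class.
module Submission where

open import Defs
open import Level using (0ℓ)
open import Data.Nat using (ℕ)
open import Data.Product using (Σ-syntax; _×_; _,_; proj₁; proj₂)
open import Data.Sum using (_⊎_; inj₁; inj₂; [_,_])
import Data.Sum as Sum
open import Function using (id; _∘_)
open import Function.Bundles using (_⇔_; mk⇔; Equivalence)
import Function.Properties.Equivalence as ⇔
open import Relation.Binary using (Rel; Setoid; IsEquivalence; _Respects_)
open import Relation.Binary.Construct.Closure.ReflexiveTransitive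
  using (Star; ε; _◅_; _◅◅_; kleisliStar; reverse; return)
import Relation.Binary.Construct.Closure.ReflexiveTransitive as Star

module _ {S : VSet} where
  open Setoid S

  EdgesRespect : Hypergraph S → Set
  EdgesRespect H = ∀ i → edge H i Respects _≈_

  -- Unlike a path, a chain may change representatives anywhere along the
  -- way, so chains compose and map along setoid morphisms without fuss.
  Step : Hypergraph S → Rel Carrier 0ℓ
  Step H x y = x ≈ y ⊎ Adj S H x y

  Chain : Hypergraph S → Rel Carrier 0ℓ
  Chain H = Star (Step H)

  module _ {H : Hypergraph S} where

    path⇒chain : ∀ {x y} → Path S H x y → Chain H x y
    path⇒chain (_ , _ , x≈x₀ , adjs , xₖ≈y) =
      inj₁ x≈x₀ ◅ Star.map inj₂ adjs ◅◅ return (inj₁ xₖ≈y)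

    chain⇒path : EdgesRespect H → ∀ {x y} → Chain H x y → Path S H x y
    chain⇒path resp {x} ε = x , x , refl , ε , refl
    chain⇒path resp (inj₁ x≈y ◅ steps) with chain⇒path resp steps
    ... | y₀ , yₖ , y≈y₀ , adjs , yₖ≈z = y₀ , yₖ , trans x≈y y≈y₀ , adjs , yₖ≈z
    chain⇒path resp (inj₂ (i , x∈i , y∈i) ◅ steps) with chain⇒path resp steps
    ... | y₀ , yₖ , y≈y₀ , adjs , yₖ≈z =
      _ , yₖ , refl , (i , x∈i , resp i y≈y₀ y∈i) ◅ adjs , yₖ≈z

    chain-sym : ∀ {x y} → Chain H x y → Chain H y x
    chain-sym = reverse step-sym
      where
      step-sym : ∀ {x y} → Step H x y → Step H y x
      step-sym (inj₁ x≈y)             = inj₁ (sym x≈y)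
      step-sym (inj₂ (i , x∈i , y∈i)) = inj₂ (i , y∈i , x∈i)

connected-onto : {S T : VSet} {H : Hypergraph S} {K : Hypergraph T} → EdgesRespect K →
  (f : Setoid.Carrier S → Setoid.Carrier T) →
  (∀ y → Σ[ x ∈ Setoid.Carrier S ] Setoid._≈_ T (f x) y) →
  (∀ {x y} → Step H x y → Chain K (f x) (f y)) →
  Connected S H → Connected T K
connected-onto {T = T} {H} {K} resp f onto step conn y y' with onto y | onto y'
... | x , fx≈y | x' , fx'≈y' = chain⇒path {H = K} resp
  (inj₁ (Setoid.sym T fx≈y) ◅ kleisliStar f step (path⇒chain {H = H} (conn x x'))
    ◅◅ inj₁ fx'≈y' ◅ ε)

module _ {S : VSet} where
  open Setoid S

  quotient-respects : (G : Hypergraph S) (R : Equiv S) → EdgesRespect (G / R)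
  quotient-respects G R i y≈y' (z , z∈i , zRy) = z , z∈i , IsEquivalence.trans (isEquiv R) zRy y≈y'

  restrict-respects : (m : Mode) {H : Hypergraph S} → EdgesRespect H →
    (I : Subset S) → EdgesRespect (restrict m H I)
  restrict-respects ⊂ resp I (i , _) = resp i
  restrict-respects ∩ resp I i       = resp i

  prodRestrict-respects : (m : Mode) {H : Hypergraph S} → EdgesRespect H →
    (R : Equiv S) → EdgesRespect (prodRestrict m H R)
  prodRestrict-respects m resp R (x , j) {y} {y'} y≈y' (xRy , y∈j) =
    xRy' , restrict-respects m resp (class S R x) j {y , xRy} {y' , xRy'} y≈y' y∈j
    where
    xRy' : rel R x y'
    xRy' = IsEquivalence.trans (isEquiv R) xRy (coarser R y≈y')

  connected-mono : {H K : Hypergraph S} → EdgesRespect K →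
    (∀ {x y} → Adj S H x y → Adj S K x y) → Connected S H → Connected S K
  connected-mono {H} {K} resp adj =
    connected-onto {H = H} {K} resp id (λ y → y , refl) (return ∘ Sum.map₂ adj)

  module _ {H : Hypergraph S} where

    adj-restrict⇒adj : ∀ m {I a b} → Adj (S ∣ˢ I) (restrict m H I) a b → Adj S H (proj₁ a) (proj₁ b)
    adj-restrict⇒adj ⊂ ((i , _) , a∈i , b∈i) = i , a∈i , b∈i
    adj-restrict⇒adj ∩ adj                   = adj

    chain-restrict⇒chain : ∀ m {I a b} → Chain (restrict m H I) a b → Chain H (proj₁ a) (proj₁ b)
    chain-restrict⇒chain m = Star.gmap proj₁ (Sum.map₂ (adj-restrict⇒adj m))

    -- Membership in a restricted edge ignores the proof that the vertex lies in the subset.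
    adj-restrict-mono : ∀ m {I J} → _⊆_ S I J → ∀ {a b} (a∈J : J (proj₁ a)) (b∈J : J (proj₁ b)) →
      Adj (S ∣ˢ I) (restrict m H I) a b → Adj (S ∣ˢ J) (restrict m H J) (proj₁ a , a∈J) (proj₁ b , b∈J)
    adj-restrict-mono ⊂ I⊆J _ _ ((i , i⊆I) , a∈i , b∈i) =
      (i , λ z z∈i → I⊆J z (i⊆I z z∈i)) , a∈i , b∈i
    adj-restrict-mono ∩ I⊆J _ _ adj = adj

    chain-restrict-mono : ∀ m {I J} → _⊆_ S I J → ∀ {a b} (a∈J : J (proj₁ a)) (b∈J : J (proj₁ b)) →
      Chain (restrict m H I) a b → Chain (restrict m H J) (proj₁ a , a∈J) (proj₁ b , b∈J)
    chain-restrict-mono m I⊆J a∈J b∈J ε = return (inj₁ refl)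
    chain-restrict-mono m I⊆J a∈J b∈J (_◅_ {j = c} (inj₁ a≈c) steps) =
      inj₁ a≈c ◅ chain-restrict-mono m I⊆J (I⊆J _ (proj₂ c)) b∈J steps
    chain-restrict-mono m {J = J} I⊆J a∈J b∈J (_◅_ {j = c} (inj₂ adj) steps) =
      inj₂ (adj-restrict-mono m I⊆J a∈J c∈J adj) ◅ chain-restrict-mono m I⊆J c∈J b∈J steps
      where
      c∈J : J (proj₁ c)
      c∈J = I⊆J _ (proj₂ c)

module _ {S : VSet} (G : Hypergraph S) where

  quotient-quotient : (R R' : Equiv S) (R≤R' : _≤E_ S R R') →
    _≈H_ (S /ˢ R) ((G / R') / bar R R' R≤R') (G / R)
  quotient-quotient R R' R≤R' = (λ i → i , image-image i) , (λ i → i , image-image i)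
    where
    open IsEquivalence (isEquiv R)
    image-image : ∀ i →
      _≐_ (S /ˢ R) (image (S /ˢ R') (bar R R' R≤R') (image S R' (edge G i))) (image S R (edge G i))
    image-image i y = mk⇔
      (λ { (z , (w , w∈i , wR'z) , zRy) → w , w∈i , trans (R≤R' _ _ wR'z) zRy })
      (λ { (z , z∈i , zRy) → z , (z , z∈i , IsEquivalence.refl (isEquiv R')) , zRy })

  module _ (R : Equiv S) where
    open IsEquivalence (isEquiv R)

    chain⇒chain-quotient : ∀ {x y} → Chain G x y → Chain (G / R) x y
    chain⇒chain-quotient = Star.map
      [ inj₁ ∘ coarser R
      , (λ { (i , x∈i , y∈i) → inj₂ (i , (_ , x∈i , refl) , (_ , y∈i , refl)) }) ]

    module _ (m : Mode) where

      ClassesChained : Set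
      ClassesChained = ∀ {x y} → rel R x y → Chain (prodRestrict m G R) x y

      chain-prodRestrict⇒rel : ∀ {x y} → Chain (prodRestrict m G R) x y → rel R x y
      chain-prodRestrict⇒rel = Star.fold (rel R) (trans ∘ step⇒rel) refl
        where
        step⇒rel : ∀ {x y} → Step (prodRestrict m G R) x y → rel R x y
        step⇒rel (inj₁ x≈y)                       = coarser R x≈y
        step⇒rel (inj₂ (_ , (zRx , _) , (zRy , _))) = trans (sym zRx) zRy

      chain-restrict⇒chain-prodRestrict : ∀ x {a b} → Chain (restrict m G (class S R x)) a b →
        Chain (prodRestrict m G R) (proj₁ a) (proj₁ b)
      chain-restrict⇒chain-prodRestrict x = Star.gmap proj₁
        (Sum.map₂ λ { (j , a∈j , b∈j) → (x , j) , (_ , a∈j) , (_ , b∈j) })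

      chain-prodRestrict⇒chain-restrict : ∀ {x u v} (xRu : rel R x u) (xRv : rel R x v) →
        Chain (prodRestrict m G R) u v → Chain (restrict m G (class S R x)) (u , xRu) (v , xRv)
      chain-prodRestrict⇒chain-restrict xRu xRv ε = return (inj₁ (Setoid.refl S))
      chain-prodRestrict⇒chain-restrict xRu xRv (inj₁ u≈w ◅ steps) =
        inj₁ u≈w ◅ chain-prodRestrict⇒chain-restrict (trans xRu (coarser R u≈w)) xRv steps
      chain-prodRestrict⇒chain-restrict {x} {u} xRu xRv
        (_◅_ {j = w} (inj₂ ((x' , j) , (x'Ru , u∈j) , (x'Rw , w∈j))) steps) =
        inj₂ (adj-restrict-mono m x'⊆x xRu xRw (j , u∈j , w∈j))
          ◅ chain-prodRestrict⇒chain-restrict xRw xRv steps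
        where
        x'⊆x : _⊆_ S (class S R x') (class S R x)
        x'⊆x z x'Rz = trans (trans xRu (sym x'Ru)) x'Rz
        xRw : rel R x w
        xRw = x'⊆x w x'Rw

      EConn⇔ClassesChained : EdgesRespect G → EConn m G R ⇔ ClassesChained
      EConn⇔ClassesChained resp = mk⇔
        (λ conn {x} {y} xRy → chain-restrict⇒chain-prodRestrict x {x , refl} {y , xRy}
          (path⇒chain {H = restrict m G (class S R x)} (conn x (x , refl) (y , xRy))))
        (λ chained x a b → chain⇒path {H = restrict m G (class S R x)}
          (restrict-respects m resp (class S R x))
          (chain-prodRestrict⇒chain-restrict (proj₂ a) (proj₂ b)
            (chained (trans (sym (proj₂ a)) (proj₂ b)))))

      components≈classes⇔ClassesChained : EdgesRespect G →
        _≈F_ S (components S (prodRestrict m G R)) (classes S R) ⇔ ClassesChained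
      components≈classes⇔ClassesChained resp = mk⇔ classes-chained components≈classes
        where
        PR : Hypergraph S
        PR = prodRestrict m G R

        classes-chained : _≈F_ S (components S PR) (classes S R) → ClassesChained
        classes-chained (_ , classes⊆components) {x} xRy with classes⊆components x
        ... | z , component≐class =
          chain-sym {H = PR} (path⇒chain {H = PR} (Equivalence.from (component≐class _) refl))
            ◅◅ path⇒chain {H = PR} (Equivalence.from (component≐class _) xRy)

        component≐class : ClassesChained → ∀ x → _≐_ S (component S PR x) (class S R x)
        component≐class chained x y = mk⇔
          (chain-prodRestrict⇒rel ∘ path⇒chain {H = PR})
          (λ xRy → chain⇒path {H = PR} (prodRestrict-respects m resp R) (chained xRy))

        components≈classes : ClassesChained → _≈F_ S (components S PR) (classes S R)
        components≈classes chained =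
          (λ x → x , component≐class chained x) , (λ x → x , component≐class chained x)

      EConn⇔components≈classes : EdgesRespect G →
        EConn m G R ⇔ _≈F_ S (components S (prodRestrict m G R)) (classes S R)
      EConn⇔components≈classes resp =
        ⇔.trans (EConn⇔ClassesChained resp) (⇔.sym (components≈classes⇔ClassesChained resp))

      module _ (conn : EConn m G R) where

        rel⇒chain : ∀ {x y} → rel R x y → Chain G x y
        rel⇒chain {x} {y} xRy = chain-restrict⇒chain m {class S R x} {x , refl} {y , xRy}
          (path⇒chain {H = restrict m G (class S R x)} (conn x (x , refl) (y , xRy)))

        chain-quotient⇒chain : ∀ {x y} → Chain (G / R) x y → Chain G x y
        chain-quotient⇒chain = kleisliStar id [ rel⇒chain ,
          (λ { (i , (z , z∈i , zRx) , (w , w∈i , wRy)) →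
                 rel⇒chain (sym zRx) ◅◅ inj₂ (i , z∈i , w∈i) ◅ rel⇒chain wRy }) ]

        component-quotient : EdgesRespect G →
          ∀ x → _≐_ (S /ˢ R) (component (S /ˢ R) (G / R) x) (image S R (component S G x))
        component-quotient resp x y = mk⇔
          (λ path → y
             , chain⇒path {H = G} resp (chain-quotient⇒chain (path⇒chain {H = G / R} path))
             , refl)
          (λ { (z , path , zRy) → chain⇒path {H = G / R} (quotient-respects G R)
                 (chain⇒chain-quotient (path⇒chain {H = G} path) ◅◅ return (inj₁ zRy)) })

        components-quotient : EdgesRespect G →
          _≈F_ (S /ˢ R) (components (S /ˢ R) (G / R)) (imageFam S R (components S G))
        components-quotient resp =
          (λ x → x , component-quotient resp x) , (λ x → x , component-quotient resp x)

module _ {S : VSet} (G : Hypergraph S) {R R' : Equiv S} (R≤R' : _≤E_ S R R') where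
  open IsEquivalence (isEquiv R)
  open IsEquivalence (isEquiv R') using () renaming (refl to R'-refl; sym to R'-sym)

  private
    S' : VSet
    S' = S /ˢ R'
    R̄ : Equiv S'
    R̄ = bar R R' R≤R'

  class-∩-image : ∀ x (A : Subset S) y →
    (rel R x y × image S R' A y) ⇔ image S R' (λ z → rel R x z × A z) y
  class-∩-image x A y = mk⇔
    (λ { (xRy , z , z∈A , zR'y) → z , (trans xRy (sym (R≤R' _ _ zR'y)) , z∈A) , zR'y })
    (λ { (z , (xRz , z∈A) , zR'y) → trans xRz (R≤R' _ _ zR'y) , z , z∈A , zR'y })

  image-⊆-class : ∀ {x} {A : Subset S} → _⊆_ S A (class S R x) → _⊆_ S' (image S R' A) (class S' R̄ x)
  image-⊆-class A⊆x y (z , z∈A , zR'y) = trans (A⊆x z z∈A) (R≤R' _ _ zR'y)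

  adj-restrict-prodRestrict⇔adj-restrict : ∀ m x {a b} →
    Adj (S ∣ˢ class S R' x) (restrict m (prodRestrict m G R) (class S R' x)) a b
      ⇔ Adj (S ∣ˢ class S R' x) (restrict m G (class S R' x)) a b
  adj-restrict-prodRestrict⇔adj-restrict ⊂ x {a} {b} = mk⇔
    (λ { (((_ , i , i⊆x'') , i⊆x) , (_ , a∈i) , (_ , b∈i)) →
           (i , λ z z∈i → i⊆x z (i⊆x'' z z∈i , z∈i)) , a∈i , b∈i })
    (λ { ((i , i⊆x) , a∈i , b∈i) →
           ((x , i , λ z z∈i → R≤R' x z (i⊆x z z∈i)) , λ { z (_ , z∈i) → i⊆x z z∈i })
             , (R≤R' x _ (proj₂ a) , a∈i) , (R≤R' x _ (proj₂ b) , b∈i) })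
  adj-restrict-prodRestrict⇔adj-restrict ∩ x {a} {b} = mk⇔
    (λ { ((_ , i) , (_ , a∈i) , (_ , b∈i)) → i , a∈i , b∈i })
    (λ { (i , a∈i , b∈i) → (x , i) , (R≤R' x _ (proj₂ a) , a∈i) , (R≤R' x _ (proj₂ b) , b∈i) })

  EConn⇔EConn-prodRestrict : ∀ m → EdgesRespect G → EConn m G R' ⇔ EConn m (prodRestrict m G R) R'
  EConn⇔EConn-prodRestrict m resp = mk⇔
    (λ conn x → connected-mono {H = restrict m G (class S R' x)}
                  {restrict m (prodRestrict m G R) (class S R' x)}
                  (restrict-respects m (prodRestrict-respects m resp R) (class S R' x))
                  (Equivalence.from (adj-restrict-prodRestrict⇔adj-restrict m x)) (conn x))
    (λ conn x → connected-mono {H = restrict m (prodRestrict m G R) (class S R' x)}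
                  {restrict m G (class S R' x)}
                  (restrict-respects m resp (class S R' x))
                  (Equivalence.to (adj-restrict-prodRestrict⇔adj-restrict m x)) (conn x))

  adj-restrict⇒adj-restrict-quotient : ∀ m x {a b} →
    Adj (S ∣ˢ class S R x) (restrict m G (class S R x)) a b →
    Adj (S' ∣ˢ class S' R̄ x) (restrict m (G / R') (class S' R̄ x)) a b
  adj-restrict⇒adj-restrict-quotient ⊂ x ((i , i⊆x) , a∈i , b∈i) =
    (i , image-⊆-class i⊆x) , (_ , a∈i , R'-refl) , (_ , b∈i , R'-refl)
  adj-restrict⇒adj-restrict-quotient ∩ x (i , a∈i , b∈i) =
    i , (_ , a∈i , R'-refl) , (_ , b∈i , R'-refl)

  EConn⇒EConn-quotient : ∀ m → EConn m G R → EConn m (G / R') R̄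
  EConn⇒EConn-quotient m conn x =
    connected-onto {H = restrict m G (class S R x)} {restrict m (G / R') (class S' R̄ x)}
    (restrict-respects m (quotient-respects G R') (class S' R̄ x)) id (λ a → a , R'-refl)
    (return ∘ Sum.map (coarser R') (adj-restrict⇒adj-restrict-quotient m x)) (conn x)

  rel'⇒chain-restrict : ∀ m → EConn m G R' → ∀ x {a b : Setoid.Carrier (S ∣ˢ class S R x)} →
    rel R' (proj₁ a) (proj₁ b) → Chain (restrict m G (class S R x)) a b
  rel'⇒chain-restrict m conn' x {u , xRu} {v , xRv} uR'v =
    chain-restrict-mono m {class S R' u} {class S R x} (λ z uR'z → trans xRu (R≤R' u z uR'z))
      {u , R'-refl} {v , uR'v} xRu xRv
      (path⇒chain {H = restrict m G (class S R' u)} (conn' u (u , R'-refl) (v , uR'v)))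

  adj-restrict-quotient⇒chain-restrict : ∀ m → EConn m G R' → ∀ x {a b} →
    Adj (S' ∣ˢ class S' R̄ x) (restrict m (G / R') (class S' R̄ x)) a b →
    Chain (restrict m G (class S R x)) a b
  adj-restrict-quotient⇒chain-restrict ⊂ conn' x {a} {b}
    ((i , i⊆x) , (z , z∈i , zR'a) , (w , w∈i , wR'b)) =
    rel'⇒chain-restrict ⊂ conn' x {a} {z , i⊆x z (z , z∈i , R'-refl)} (R'-sym zR'a)
      ◅◅ inj₂ ((i , λ y y∈i → i⊆x y (y , y∈i , R'-refl)) , z∈i , w∈i)
      ◅ rel'⇒chain-restrict ⊂ conn' x {w , i⊆x w (w , w∈i , R'-refl)} {b} wR'b
  adj-restrict-quotient⇒chain-restrict ∩ conn' x {a} {b}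
    (i , (z , z∈i , zR'a) , (w , w∈i , wR'b)) =
    rel'⇒chain-restrict ∩ conn' x {a} {z , trans (proj₂ a) (sym (R≤R' _ _ zR'a))} (R'-sym zR'a)
      ◅◅ inj₂ (i , z∈i , w∈i)
      ◅ rel'⇒chain-restrict ∩ conn' x {w , trans (proj₂ b) (sym (R≤R' _ _ wR'b))} {b} wR'b

  EConn-quotient⇒EConn : ∀ m → EdgesRespect G → EConn m G R' → EConn m (G / R') R̄ → EConn m G R
  EConn-quotient⇒EConn m resp conn' conn x =
    connected-onto {H = restrict m (G / R') (class S' R̄ x)} {restrict m G (class S R x)}
    (restrict-respects m resp (class S R x)) id (λ a → a , Setoid.refl S)
    [ rel'⇒chain-restrict m conn' x , adj-restrict-quotient⇒chain-restrict m conn' x ] (conn x)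

  EConn-tower : ∀ m → EdgesRespect G →
    (EConn m G R' × EConn m (G / R') R̄) ⇔ (EConn m G R × EConn m (prodRestrict m G R) R')
  EConn-tower m resp = mk⇔
    (λ { (conn' , conn̄) → EConn-quotient⇒EConn m resp conn' conn̄
                          , Equivalence.to (EConn⇔EConn-prodRestrict m resp) conn' })
    (λ { (conn , connPR) → Equivalence.from (EConn⇔EConn-prodRestrict m resp) connPR
                         , EConn⇒EConn-quotient m conn })

  prodRestrict-quotient : ∀ m → _≈H_ S' (prodRestrict m (G / R') R̄) (prodRestrict m G R / R')
  prodRestrict-quotient ⊂ =
    (λ { (x , i , i⊆x) → (x , i , λ z z∈i → i⊆x z (z , z∈i , R'-refl)) , class-∩-image x (edge G i) })
    , (λ { (x , i , i⊆x) → (x , i , image-⊆-class i⊆x) , class-∩-image x (edge G i) })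
  prodRestrict-quotient ∩ =
    (λ { (x , i) → (x , i) , class-∩-image x (edge G i) })
    , (λ { (x , i) → (x , i) , class-∩-image x (edge G i) })

lemma1p5 : (n : ℕ) (G : Hypergraph (FinS n)) → IsHypergraph (FinS n) G → (m : Mode) →
    ((R R' : Equiv (FinS n)) (le : _≤E_ (FinS n) R R') →
      _≈H_ (FinS n /ˢ R) ((G / R') / bar R R' le) (G / R))
    × ((R : Equiv (FinS n)) →
      (EConn m G R ⇔ _≈F_ (FinS n) (components (FinS n) (prodRestrict m G R)) (classes (FinS n) R)))
    × ((R : Equiv (FinS n)) → EConn m G R →
      _≈F_ (FinS n /ˢ R) (components (FinS n /ˢ R) (G / R)) (imageFam (FinS n) R (components (FinS n) G)))
    × ((R R' : Equiv (FinS n)) (le : _≤E_ (FinS n) R R') →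
      ((EConn m G R' × EConn m (G / R') (bar R R' le)) ⇔ (EConn m G R × EConn m (prodRestrict m G R) R'))
      × ((EConn m G R' × EConn m (G / R') (bar R R' le)) →
        _≈H_ (FinS n /ˢ R') (prodRestrict m (G / R') (bar R R' le)) (prodRestrict m G R / R')))
lemma1p5 n G isHypergraph m =
  quotient-quotient G
  , (λ R → EConn⇔components≈classes G R m resp)
  , (λ R conn → components-quotient G R m conn resp)
  , (λ R R' R≤R' → EConn-tower G {R} {R'} R≤R' m resp
                  , λ _ → prodRestrict-quotient G {R} {R'} R≤R' m)
  where
  resp : EdgesRespect G
  resp = IsHypergraph.edge-resp isHypergraph
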